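{- Let $\alpha = \omega^{m_0} + \omega^{m_1} + \cdots + \omega^{m_{k-1}}$ where $k \ge 1$ and $m_0 \ge m_1 \ge \cdots \ge m_{k-1}$ are natural numbers, and let $\beta < \alpha$ be an ordinal. Then $\alpha \not\equiv_{2m_0 + k} \beta$.
   Context: Ordinals are regarded as linear orders; $+$ and powers are ordinal operations. For $n \ge 1$, $X \equiv_n Y$ means player II has a winning strategy in the $n$-move Ehrenfeucht–Fraïssé game on the linear orders $X$ and $Y$ (each move: I picks an element of either structure, II an element of the other; II wins if the correspondence between chosen elements is an order-isomorphism of the induced substructures). -}

module Defs where

open import Data.Nat using (ℕ; zero; suc; _+_; _*_; _≤_; _<_)
open import Data.Fin as Fin using (Fin)
open import Data.Vec using (Vec; []; _∷_; lookup)
open import Data.List using (List; []; _∷_)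
open import Data.Sum using (_⊎_; inj₁; inj₂)
open import Data.Product using (Σ; ∃; _×_; _,_; proj₁; proj₂)
open import Data.Empty using (⊥)
open import Data.Unit using (⊤)
open import Relation.Binary.PropositionalEquality using (_≡_)
open import Function using (_⇔_)

record LinOrd : Set₁ where
  field
    Carrier : Set
    _≺_     : Carrier → Carrier → Set
open LinOrd public

𝟘 : LinOrd
𝟘 = record { Carrier = ⊥ ; _≺_ = λ _ _ → ⊥ }

sumRel : (X Y : LinOrd) → (Carrier X ⊎ Carrier Y) → (Carrier X ⊎ Carrier Y) → Set
sumRel X Y (inj₁ x) (inj₁ x') = _≺_ X x x'
sumRel X Y (inj₁ x) (inj₂ y)  = ⊤
sumRel X Y (inj₂ y) (inj₁ x)  = ⊥
sumRel X Y (inj₂ y) (inj₂ y') = _≺_ Y y y'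

_⊕_ : LinOrd → LinOrd → LinOrd
X ⊕ Y = record { Carrier = Carrier X ⊎ Carrier Y ; _≺_ = sumRel X Y }

-- ω^m as the lexicographic order on ℕ^m (first coordinate most significant);
-- ω^0 = 1 and ω^(m+1) = ω^m · ω (ω copies of ω^m indexed by the first coordinate).
lex : (m : ℕ) → Vec ℕ m → Vec ℕ m → Set
lex zero [] [] = ⊥
lex (suc m) (x ∷ u) (y ∷ v) = x < y ⊎ (x ≡ y × lex m u v)

ω^ : ℕ → LinOrd
ω^ m = record { Carrier = Vec ℕ m ; _≺_ = lex m }

sumω : ∀ {k} → Vec ℕ k → LinOrd
sumω [] = 𝟘
sumω (m ∷ ms) = ω^ m ⊕ sumω ms

-- Ehrenfeucht–Fraïssé game.  A position is the list of pairs chosen so far.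
PartialIso : (X Y : LinOrd) → List (Carrier X × Carrier Y) → Set
PartialIso X Y ps =
  ∀ p q → p Data.List.Membership.Propositional.∈ ps → q Data.List.Membership.Propositional.∈ ps →
    ((_≺_ X (proj₁ p) (proj₁ q)) ⇔ (_≺_ Y (proj₂ p) (proj₂ q))) ×
    ((proj₁ p ≡ proj₁ q) ⇔ (proj₂ p ≡ proj₂ q))
  where import Data.List.Membership.Propositional

IIWins : (X Y : LinOrd) → ℕ → List (Carrier X × Carrier Y) → Set
IIWins X Y zero ps = PartialIso X Y ps
IIWins X Y (suc n) ps =
  ((x : Carrier X) → Σ (Carrier Y) λ y → IIWins X Y n ((x , y) ∷ ps)) ×
  ((y : Carrier Y) → Σ (Carrier X) λ x → IIWins X Y n ((x , y) ∷ ps))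

_≡[_]_ : LinOrd → ℕ → LinOrd → Set
X ≡[ n ] Y = IIWins X Y n []

-- β < α for a well-order α: β is order-isomorphic to a proper initial segment
-- {x ∈ α | x < a} of α.
record IsoToInitialSegment (B A : LinOrd) : Set where
  field
    bound    : Carrier A
    f        : Carrier B → Carrier A
    below    : ∀ b → _≺_ A (f b) bound
    onto     : ∀ a → _≺_ A a bound → Σ (Carrier B) λ b → f b ≡ a
    injective : ∀ b b' → f b ≡ f b' → b ≡ b'
    monotone : ∀ b b' → (_≺_ B b b') ⇔ (_≺_ A (f b) (f b'))

_<ord_ : LinOrd → LinOrd → Set
β <ord α = IsoToInitialSegment β α

NonIncreasing : ∀ {k} → Vec ℕ k → Set
NonIncreasing {k} ms = ∀ (i j : Fin k) → i Fin.≤ j → lookup ms j ≤ lookup ms i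

module Submission where

-- We exhibit
-- a property of subsets P of a linear order, LongSum ms P, that
--   (1) holds for the whole of α                       (sumω-longSum),
--   (2) fails for every bounded subset of α             (bounded-notLongSum),
--   (3) is expressible with quantifier rank rankSum ms ≤ 2m₀ + k, so that a
--       winning strategy for II transfers it from α to β  (Game.transfer-LongSum),
--   (4) is invariant under order isomorphisms between subsets (Transport).
-- Since β is isomorphic to the bounded subset of α below some point, (1)–(4)
-- show α ≢_{2m₀+k} β.  LongSum is built from Long j ("at least as long as ω^j"):
-- P is nonempty, and above each z ∈ P there is w ∈ P with P ∩ (z , w) (j-1)-long.

open import Defs
open import Data.Nat using (ℕ; zero; suc; _+_; _*_; _≤_; _⊔_; z≤n; s≤s)
open import Data.Nat.Properties
open import Data.Vec using (Vec; []; _∷_; head; lookup; replicate)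
open import Data.Vec.Properties using (∷-injectiveʳ)
open import Data.List using (List; []; _∷_)
open import Data.List.Relation.Unary.Any using (here; there)
open import Data.List.Membership.Propositional using (_∈_)
open import Data.List.Relation.Binary.Subset.Propositional using (_⊆_)
open import Data.Sum using (_⊎_; inj₁; inj₂; map₁)
open import Data.Sum.Properties using (inj₁-injective; inj₂-injective)
open import Data.Sum.Function.Propositional using (_⊎-⇔_)
open import Data.Product using (Σ; _×_; _,_; proj₁; proj₂)
open import Data.Product.Function.NonDependent.Propositional using (_×-⇔_)
open import Data.Empty using (⊥-elim)
open import Data.Unit using (tt)
import Data.Fin as Fin
open import Function using (_⇔_; mk⇔; Equivalence)
open import Function.Construct.Identity using (⇔-id)
open import Function.Construct.Symmetry using (⇔-sym)
open import Level using (0ℓ)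
open import Relation.Nullary using (¬_)
open import Relation.Unary using (Pred; U; Satisfiable; _∩_)
open import Relation.Binary.PropositionalEquality using (_≡_; refl; sym; cong; subst; module ≡-Reasoning)

open Equivalence using (to; from)

Lt : (X : LinOrd) → Carrier X → Carrier X → Set
Lt X = _≺_ X
syntax Lt X x y = x ≺[ X ] y

Subset : LinOrd → Set₁
Subset X = Pred (Carrier X) 0ℓ

Below Above AtLeast : (X : LinOrd) → Carrier X → Subset X
Below   X w u = u ≺[ X ] w
Above   X z u = z ≺[ X ] u
AtLeast X z u = z ≡ u ⊎ z ≺[ X ] u

Between : (X : LinOrd) → Carrier X → Carrier X → Subset X
Between X z w = Above X z ∩ Below X w

UpClosed : (X : LinOrd) → Subset X → Set
UpClosed X P = ∀ {z u} → P z → z ≺[ X ] u → P u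

-- Long X j P: P is nonempty and, for j > 0, above every z ∈ P there is some
-- w ∈ P such that P ∩ (z , w) is (j-1)-long.  It is expressed by a formula of
-- quantifier rank 2j+1 relativised to P.
Long : (X : LinOrd) → ℕ → Subset X → Set
Long X zero    P = Satisfiable P
Long X (suc j) P = Satisfiable P ×
  ((z : Carrier X) → P z →
     Σ (Carrier X) λ w → P w × z ≺[ X ] w × Long X j (P ∩ Between X z w))

LongSum : (X : LinOrd) {k : ℕ} → Vec ℕ (suc k) → Subset X → Set
LongSum X (m ∷ [])     P = Long X m P
LongSum X (m ∷ m' ∷ ms) P = Σ (Carrier X) λ x → P x ×
  Long X m (P ∩ Below X x) × LongSum X (m' ∷ ms) (P ∩ AtLeast X x)

-- Number of moves needed to transfer Long and LongSum along a game.
rank : ℕ → ℕ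
rank zero    = 1
rank (suc j) = suc (suc (rank j))

rankSum : ∀ {k} → Vec ℕ (suc k) → ℕ
rankSum (m ∷ [])      = rank m
rankSum (m ∷ m' ∷ ms) = suc (rank m ⊔ rankSum (m' ∷ ms))

-- How a relation R between X and Y treats subsets and points; used both for
-- the legal moves of a game position and for a fixed order correspondence.
module Agreement (X Y : LinOrd) where

  Agree : (Carrier X → Carrier Y → Set) → Subset X → Subset Y → Set
  Agree R P Q = ∀ x y → R x y → P x ⇔ Q y

  Anchored : (Carrier X → Carrier Y → Set) → Carrier X → Carrier Y → Set
  Anchored R z z' = ∀ x y → R x y →
    (z ≺[ X ] x ⇔ z' ≺[ Y ] y) × (x ≺[ X ] z ⇔ y ≺[ Y ] z') × (z ≡ x ⇔ z' ≡ y)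

  module _ {R : Carrier X → Carrier Y → Set} where

    agree-∩ : ∀ {P P' : Subset X} {Q Q' : Subset Y} →
      Agree R P Q → Agree R P' Q' → Agree R (P ∩ P') (Q ∩ Q')
    agree-∩ ag ag' x y r = ag x y r ×-⇔ ag' x y r

    agree-above : ∀ {z z'} → Anchored R z z' → Agree R (Above X z) (Above Y z')
    agree-above anc x y r = proj₁ (anc x y r)

    agree-below : ∀ {w w'} → Anchored R w w' → Agree R (Below X w) (Below Y w')
    agree-below anc x y r = proj₁ (proj₂ (anc x y r))

    agree-between : ∀ {z z' w w'} → Anchored R z z' → Anchored R w w' →
      Agree R (Between X z w) (Between Y z' w')
    agree-between anc anc' = agree-∩ (agree-above anc) (agree-below anc')

    agree-atLeast : ∀ {z z'} → Anchored R z z' → Agree R (AtLeast X z) (AtLeast Y z')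
    agree-atLeast anc x y r = proj₂ (proj₂ (anc x y r)) ⊎-⇔ proj₁ (anc x y r)

module Game (X Y : LinOrd) where
  open Agreement X Y

  Position : Set
  Position = List (Carrier X × Carrier Y)

  Extends : Position → Carrier X → Carrier Y → Set
  Extends ps x y = PartialIso X Y ((x , y) ∷ ps)

  partialIso-⊆ : ∀ {ps qs : Position} → ps ⊆ qs → PartialIso X Y qs → PartialIso X Y ps
  partialIso-⊆ ps⊆qs iso p q p∈ q∈ = iso p q (ps⊆qs p∈) (ps⊆qs q∈)

  winning⇒partialIso : ∀ n ps → IIWins X Y n ps → PartialIso X Y ps
  winning⇒partialIso zero    ps             iso         = iso
  winning⇒partialIso (suc n) []             _           = λ _ _ ()
  winning⇒partialIso (suc n) ((x , _) ∷ ps) (forth , _) =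
    partialIso-⊆ there (winning⇒partialIso n _ (proj₂ (forth x)))

  weaken : ∀ {m n} ps → m ≤ n → IIWins X Y n ps → IIWins X Y m ps
  weaken {zero}  {n} ps _ w = winning⇒partialIso n ps w
  weaken {suc m} ps (s≤s m≤n) (forth , back) =
    (λ x → proj₁ (forth x) , weaken _ m≤n (proj₂ (forth x))) ,
    (λ y → proj₁ (back y)  , weaken _ m≤n (proj₂ (back y)))

  agree-extend : ∀ {ps p} {P : Subset X} {Q : Subset Y} →
    Agree (Extends ps) P Q → Agree (Extends (p ∷ ps)) P Q
  agree-extend ag x y iso = ag x y (partialIso-⊆ skip-second iso)
    where
      skip-second : ∀ {a b ps} → (a ∷ ps) ⊆ (a ∷ b ∷ ps)
      skip-second (here eq) = here eq
      skip-second (there p∈) = there (there p∈)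

  played-anchored : ∀ {ps z z'} → (z , z') ∈ ps → Anchored (Extends ps) z z'
  played-anchored z∈ _ _ iso =
    proj₁ (iso _ _ (there z∈) (here refl)) ,
    proj₁ (iso _ _ (here refl) (there z∈)) ,
    proj₂ (iso _ _ (there z∈) (here refl))

  -- A strategy for rank j moves carries Long j from P to Q: for z' ∈ Q, II's
  -- reply z ∈ P has a witness w, and II's reply w' to w is a witness for z'.
  transfer-Long : ∀ j {ps} {P : Subset X} {Q : Subset Y} →
    Agree (Extends ps) P Q → IIWins X Y (rank j) ps → Long X j P → Long Y j Q
  transfer-Long zero ag (forth , _) (x , px) =
    proj₁ (forth x) , to (ag _ _ (winning⇒partialIso 0 _ (proj₂ (forth x)))) px
  transfer-Long (suc j) {ps} {Q = Q} ag W@(_ , back) (nonempty , climb) =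
    transfer-Long zero ag (weaken ps (s≤s z≤n) W) nonempty , climb'
    where
      climb' : (z' : Carrier Y) → Q z' →
        Σ (Carrier Y) λ w' → Q w' × z' ≺[ Y ] w' × Long Y j (Q ∩ Between Y z' w')
      climb' z' qz' with back z'
      ... | z , W₁ with climb z (from (ag _ _ (winning⇒partialIso _ _ W₁)) qz')
      ...   | w , pw , z≺w , long with proj₁ W₁ w
      ...     | w' , W₂ =
        w' , to (agree-extend ag _ _ iso) pw , to (proj₁ (played-anchored (here refl) _ _ iso)) z≺w ,
        transfer-Long j
          (agree-∩ (agree-extend (agree-extend ag))
                   (agree-between (played-anchored (there (here refl))) (played-anchored (here refl))))
          W₂ long
        where iso = winning⇒partialIso _ _ W₂

  -- II's answer to the splitting point leaves enough moves for both pieces.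
  transfer-LongSum : ∀ {k} (ms : Vec ℕ (suc k)) {ps} {P : Subset X} {Q : Subset Y} →
    Agree (Extends ps) P Q → IIWins X Y (rankSum ms) ps → LongSum X ms P → LongSum Y ms Q
  transfer-LongSum (m ∷ []) = transfer-Long m
  transfer-LongSum (m ∷ m' ∷ ms) ag (forth , _) (x , px , front , rest) =
    y , to (ag _ _ (winning⇒partialIso _ _ W)) px ,
    transfer-Long m
      (agree-∩ (agree-extend ag) (agree-below (played-anchored (here refl))))
      (weaken _ (m≤m⊔n (rank m) (rankSum (m' ∷ ms))) W) front ,
    transfer-LongSum (m' ∷ ms)
      (agree-∩ (agree-extend ag) (agree-atLeast (played-anchored (here refl))))
      (weaken _ (m≤n⊔m (rank m) (rankSum (m' ∷ ms))) W) rest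
    where
      y = proj₁ (forth x)
      W = proj₂ (forth x)

-- A correspondence between X and Y all of whose related pairs are anchored:
-- a partial order-isomorphism, given as a relation.
record Corr (X Y : LinOrd) : Set₁ where
  field
    _∼_      : Carrier X → Carrier Y → Set
    anchored : ∀ {z z'} → z ∼ z' → Agreement.Anchored X Y _∼_ z z'

flip : ∀ {X Y} → Corr X Y → Corr Y X
flip C = record
  { _∼_      = λ y x → x ∼ y
  ; anchored = λ z∼z' x y x∼y → let (≺₁ , ≺₂ , ≡₁) = anchored z∼z' y x x∼y in
                                 ⇔-sym ≺₁ , ⇔-sym ≺₂ , ⇔-sym ≡₁
  }
  where open Corr C

record Embedding (X Y : LinOrd) : Set where
  field
    fun       : Carrier X → Carrier Y
    monotone  : ∀ {x x'} → x ≺[ X ] x' ⇔ fun x ≺[ Y ] fun x'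
    injective : ∀ {x x'} → fun x ≡ fun x' → x ≡ x'

graph : ∀ {X Y} → Embedding X Y → Corr X Y
graph {X} {Y} E = record { _∼_ = λ x y → fun x ≡ y ; anchored = anchor }
  where
    open Embedding E
    anchor : ∀ {z z'} → fun z ≡ z' → Agreement.Anchored X Y (λ x y → fun x ≡ y) z z'
    anchor refl _ _ refl = monotone , monotone , mk⇔ (cong fun) injective

-- C restricts to a bijection between P and Q.
record Matches {X Y : LinOrd} (C : Corr X Y) (P : Subset X) (Q : Subset Y) : Set where
  field
    forth : ∀ {x} → P x → Σ (Carrier Y) λ y → Corr._∼_ C x y
    back  : ∀ {y} → Q y → Σ (Carrier X) λ x → Corr._∼_ C x y
    agree : Agreement.Agree X Y (Corr._∼_ C) P Q

matches-∩ : ∀ {X Y} {C : Corr X Y} {P P' Q Q'} → Matches C P Q →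
  Agreement.Agree X Y (Corr._∼_ C) P' Q' → Matches C (P ∩ P') (Q ∩ Q')
matches-∩ {X} {Y} M ag' = record
  { forth = λ (px , _) → forth px
  ; back  = λ (qy , _) → back qy
  ; agree = Agreement.agree-∩ X Y agree ag'
  }
  where open Matches M

matches-flip : ∀ {X Y} {C : Corr X Y} {P Q} → Matches C P Q → Matches (flip C) Q P
matches-flip M = record
  { forth = back
  ; back  = forth
  ; agree = λ y x x∼y → ⇔-sym (agree x y x∼y)
  }
  where open Matches M

matches-graph : ∀ {X Y} (E : Embedding X Y) {P : Subset X} {Q : Subset Y} →
  (∀ {y} → Q y → Σ (Carrier X) λ x → Embedding.fun E x ≡ y) →
  (∀ x → P x ⇔ Q (Embedding.fun E x)) → Matches (graph E) P Q
matches-graph E image preimage = record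
  { forth = λ {x} _ → Embedding.fun E x , refl
  ; back  = image
  ; agree = λ { x _ refl → preimage x }
  }

module Transport {X Y : LinOrd} (C : Corr X Y) where
  open Corr C
  open Agreement X Y
  open Matches

  transport-Long : ∀ j {P Q} → Matches C P Q → Long X j P → Long Y j Q
  transport-Long zero M (x , px) =
    proj₁ (forth M px) , to (agree M _ _ (proj₂ (forth M px))) px
  transport-Long (suc j) {Q = Q} M (nonempty , climb) = transport-Long zero M nonempty , climb'
    where
      climb' : (z' : Carrier Y) → Q z' →
        Σ (Carrier Y) λ w' → Q w' × z' ≺[ Y ] w' × Long Y j (Q ∩ Between Y z' w')
      climb' z' qz' with back M qz'
      ... | z , z∼z' with climb z (from (agree M _ _ z∼z') qz')
      ...   | w , pw , z≺w , long with forth M pw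
      ...     | w' , w∼w' =
        w' , to (agree M _ _ w∼w') pw , to (proj₁ (anchored z∼z' _ _ w∼w')) z≺w ,
        transport-Long j (matches-∩ M (agree-between (anchored z∼z') (anchored w∼w'))) long

  transport-LongSum : ∀ {k} (ms : Vec ℕ (suc k)) {P Q} → Matches C P Q →
    LongSum X ms P → LongSum Y ms Q
  transport-LongSum (m ∷ []) = transport-Long m
  transport-LongSum (m ∷ m' ∷ ms) M (x , px , front , rest) with forth M px
  ... | y , x∼y =
    y , to (agree M _ _ x∼y) px ,
    transport-Long m (matches-∩ M (agree-below (anchored x∼y))) front ,
    transport-LongSum (m' ∷ ms) (matches-∩ M (agree-atLeast (anchored x∼y))) rest

open Transport using (transport-Long; transport-LongSum)

lex-trans : ∀ m {u v w : Vec ℕ m} → lex m u v → lex m v w → lex m u w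
lex-trans zero {[]} {[]} {[]} ()
lex-trans (suc m) {_ ∷ _} {_ ∷ _} {_ ∷ _} (inj₁ a<b)          (inj₁ b<c)          = inj₁ (<-trans a<b b<c)
lex-trans (suc m) {_ ∷ _} {_ ∷ _} {_ ∷ _} (inj₁ a<b)          (inj₂ (refl , _))   = inj₁ a<b
lex-trans (suc m) {_ ∷ _} {_ ∷ _} {_ ∷ _} (inj₂ (refl , _))   (inj₁ b<c)          = inj₁ b<c
lex-trans (suc m) {_ ∷ _} {_ ∷ _} {_ ∷ _} (inj₂ (refl , u<v)) (inj₂ (refl , v<w)) =
  inj₂ (refl , lex-trans m u<v v<w)

zeros-least : ∀ m (v : Vec ℕ m) → AtLeast (ω^ m) (replicate m 0) v
zeros-least zero    []          = inj₁ refl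
zeros-least (suc m) (suc a ∷ v) = inj₂ (inj₁ (s≤s z≤n))
zeros-least (suc m) (zero ∷ v) with zeros-least m v
... | inj₁ eq  = inj₁ (cong (0 ∷_) eq)
... | inj₂ 0<v = inj₂ (inj₂ (refl , 0<v))

nothing-below-zeros : ∀ m {v : Vec ℕ m} → ¬ lex m v (replicate m 0)
nothing-below-zeros (suc m) {_ ∷ _} (inj₂ (refl , v<0)) = nothing-below-zeros m v<0

no-maximum : ∀ m (v : Vec ℕ (suc m)) → Satisfiable (Above (ω^ (suc m)) v)
no-maximum m (a ∷ v) = suc a ∷ v , inj₁ (n<1+n a)

lex-head : ∀ m {a b} {u v : Vec ℕ m} → lex (suc m) (a ∷ u) (b ∷ v) → a ≤ b
lex-head m (inj₁ a<b)        = <⇒≤ a<b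
lex-head m (inj₂ (refl , _)) = ≤-refl

prefix : ∀ {m} → ℕ → Embedding (ω^ m) (ω^ (suc m))
prefix {m} a = record
  { fun       = a ∷_
  ; monotone  = mk⇔ (λ u<v → inj₂ (refl , u<v)) same-head
  ; injective = ∷-injectiveʳ
  }
  where
    same-head : ∀ {u v} → lex (suc m) (a ∷ u) (a ∷ v) → lex m u v
    same-head (inj₁ a<a)        = ⊥-elim (<-irrefl refl a<a)
    same-head (inj₂ (_ , u<v)) = u<v

block-convex : ∀ m {a} {u v : Vec ℕ m} {x : Vec ℕ (suc m)} →
  lex (suc m) (a ∷ u) x → lex (suc m) x (a ∷ v) → Σ (Vec ℕ m) λ t → a ∷ t ≡ x
block-convex m {x = _ ∷ t} (inj₂ (refl , _)) _                  = t , refl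
block-convex m {x = _ ∷ t} (inj₁ a<b)        (inj₁ b<a)          = ⊥-elim (<-asym a<b b<a)
block-convex m {x = _ ∷ t} (inj₁ a<b)        (inj₂ (refl , _))   = ⊥-elim (<-irrefl refl a<b)

block-to-next : ∀ m {a} {u : Vec ℕ m} {x : Vec ℕ (suc m)} →
  lex (suc m) (a ∷ u) x → lex (suc m) x (suc a ∷ replicate m 0) → Σ (Vec ℕ m) λ t → a ∷ t ≡ x
block-to-next m {x = _ ∷ t} (inj₂ (refl , _)) _                 = t , refl
block-to-next m {x = _ ∷ t} (inj₁ a<b)        (inj₁ b<1+a)      = ⊥-elim (<-irrefl refl (<-≤-trans a<b (≤-pred b<1+a)))
block-to-next m {x = _ ∷ t} (inj₁ a<b)        (inj₂ (refl , t<0)) = ⊥-elim (nothing-below-zeros m t<0)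

-- A nonempty upward closed subset of ω^(m+1) is (m+1)-long: above a ∷ t take
-- w = (a+1) ∷ 0; the interval (a ∷ t , w) is a copy of the part of ω^m above t.
upClosed-long : ∀ m {P : Subset (ω^ (suc m))} →
  UpClosed (ω^ (suc m)) P → Satisfiable P → Long (ω^ (suc m)) (suc m) P
upClosed-long zero {P} up nonempty = nonempty , climb
  where
    climb : (z : Vec ℕ 1) → P z →
      Σ (Vec ℕ 1) λ w → P w × lex 1 z w × Long (ω^ 1) 0 (P ∩ Between (ω^ 1) z w)
    climb (a ∷ []) pz =
      (2 + a ∷ []) , up pz a<2+a , a<2+a , (1 + a ∷ [] , up pz a<1+a , a<1+a , inj₁ (n<1+n (1 + a)))
      where
        a<1+a = inj₁ (n<1+n a)
        a<2+a = inj₁ (<-trans (n<1+n a) (n<1+n (1 + a)))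
upClosed-long (suc m) {P} up nonempty = nonempty , climb
  where
    climb : (z : Vec ℕ (2 + m)) → P z →
      Σ (Vec ℕ (2 + m)) λ w → P w × lex (2 + m) z w × Long (ω^ (2 + m)) (suc m) (P ∩ Between (ω^ (2 + m)) z w)
    climb (a ∷ t) pz =
      next , up pz (below-next t) , below-next t ,
      transport-Long (graph (prefix a)) (suc m) block
        (upClosed-long m (lex-trans (suc m)) (no-maximum m t))
      where
        next = suc a ∷ replicate (suc m) 0
        below-next : ∀ s → lex (2 + m) (a ∷ s) next
        below-next _ = inj₁ (n<1+n a)
        block : Matches (graph (prefix a)) (Above (ω^ (suc m)) t) (P ∩ Between (ω^ (2 + m)) (a ∷ t) next)
        block = matches-graph (prefix a) (λ (_ , t<x , x<next) → block-to-next (suc m) t<x x<next)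
          λ s → mk⇔ (λ t<s → up pz (inj₂ (refl , t<s)) , inj₂ (refl , t<s) , below-next s)
                    (λ (_ , t<s , _) → from (Embedding.monotone (prefix a)) t<s)

ω^-long : ∀ m → Long (ω^ m) m U
ω^-long zero    = [] , tt
ω^-long (suc m) = upClosed-long m (λ _ _ → tt) (replicate (suc m) 0 , tt)

-- For m > 0, the witnesses w have
-- to climb to higher blocks (which the bound stops after finitely many steps)
-- unless some interval inside one block is (m-1)-long, contradicting the claim
-- for m-1 in that block.
bounded-notLong : ∀ m {P : Subset (ω^ m)} c → (∀ {u} → P u → lex m u c) → ¬ Long (ω^ m) m P
bounded-notLong zero    []       bounded ([] , p)           = bounded p
bounded-notLong (suc m) {P} (c ∷ _) bounded ((u , pu) , climb) =
  1+n≰n (m+n≤o⇒n≤o (head u) (heads-low (suc c) pu))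
  where
    heads-low : ∀ n {z} → P z → head z + n ≤ c
    heads-low zero {a ∷ _} pz = subst (_≤ c) (sym (+-identityʳ a)) (lex-head m (bounded pz))
    heads-low (suc n) {a ∷ t} pz with climb (a ∷ t) pz
    ... | (b ∷ _) , pw , inj₁ a<b , _ = begin
      a + suc n ≡⟨ +-suc a n ⟩
      suc a + n ≤⟨ +-monoˡ-≤ n a<b ⟩
      b + n     ≤⟨ heads-low n pw ⟩
      c         ∎
      where open ≤-Reasoning
    ... | (.a ∷ s) , _ , inj₂ (refl , _) , long = ⊥-elim
      (bounded-notLong m s (λ (_ , _ , x<w) → from (Embedding.monotone (prefix a)) x<w)
        (transport-Long (flip (graph (prefix a))) m
          (matches-flip (matches-graph (prefix a) (λ (_ , z<x , x<w) → block-convex m z<x x<w)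
                                                  (λ _ → ⇔-id _)))
          long))

inl : ∀ {X Y} → Embedding X (X ⊕ Y)
inl = record { fun = inj₁ ; monotone = ⇔-id _ ; injective = inj₁-injective }

inr : ∀ {X Y} → Embedding Y (X ⊕ Y)
inr = record { fun = inj₂ ; monotone = ⇔-id _ ; injective = inj₂-injective }

below-left : ∀ X Y {v u} → u ≺[ X ⊕ Y ] inj₁ v → Σ (Carrier X) λ v' → inj₁ v' ≡ u
below-left X Y {u = inj₁ v'} _ = v' , refl

atLeast-right : ∀ X Y {y u} → AtLeast (X ⊕ Y) (inj₂ y) u → Σ (Carrier Y) λ y' → inj₂ y' ≡ u
atLeast-right X Y {u = inj₂ y'} _ = y' , refl
atLeast-right X Y {u = inj₁ _} (inj₁ ())

least : ∀ {k} (ms : Vec ℕ (suc k)) → Carrier (sumω ms)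
least (m ∷ _) = inj₁ (replicate m 0)

least-atLeast : ∀ {k} (ms : Vec ℕ (suc k)) y → AtLeast (sumω ms) (least ms) y
least-atLeast (m ∷ _) (inj₁ v) with zeros-least m v
... | inj₁ eq  = inj₁ (cong inj₁ eq)
... | inj₂ 0<v = inj₂ 0<v
least-atLeast (m ∷ _) (inj₂ _) = inj₂ tt

nothing-below-least : ∀ {k} (ms : Vec ℕ (suc k)) {y} → ¬ y ≺[ sumω ms ] least ms
nothing-below-least (m ∷ _) {inj₁ _} v<0 = nothing-below-zeros m v<0

-- α = ω^m₀ + … + ω^m_{k-1} satisfies LongSum for its own exponents:
-- split at the start of the last k-1 summands.
sumω-longSum : ∀ {k} (ms : Vec ℕ (suc k)) → LongSum (sumω ms) ms U
sumω-longSum (m ∷ []) =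
  transport-Long (graph inl) m (matches-graph inl only-left (λ _ → ⇔-id _)) (ω^-long m)
  where
    only-left : ∀ {u} → U u → Σ (Vec ℕ m) λ v → inj₁ v ≡ u
    only-left {inj₁ v} _ = v , refl
    only-left {inj₂ ()}
sumω-longSum (m ∷ m' ∷ ms) =
  inj₂ start , tt ,
  transport-Long (graph inl) m (matches-graph inl left-part λ _ → mk⇔ (λ _ → tt , tt) (λ _ → tt)) (ω^-long m) ,
  transport-LongSum (graph inr) (m' ∷ ms) (matches-graph inr right-part right-preimage)
    (sumω-longSum (m' ∷ ms))
  where
    α     = sumω (m ∷ m' ∷ ms)
    start = least (m' ∷ ms)
    left-part : ∀ {u} → (U ∩ Below α (inj₂ start)) u → Σ (Vec ℕ m) λ v → inj₁ v ≡ u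
    left-part {inj₁ v} _         = v , refl
    left-part {inj₂ y} (_ , y<s) = ⊥-elim (nothing-below-least (m' ∷ ms) {y} y<s)
    right-part : ∀ {u} → (U ∩ AtLeast α (inj₂ start)) u → Σ (Carrier (sumω (m' ∷ ms))) λ y → inj₂ y ≡ u
    right-part (_ , s≤u) = atLeast-right (ω^ m) (sumω (m' ∷ ms)) s≤u
    right-preimage : ∀ y → U y ⇔ (U ∩ AtLeast α (inj₂ start)) (inj₂ y)
    right-preimage y =
      mk⇔ (λ _ → tt , map₁ (cong inj₂) (least-atLeast (m' ∷ ms) y)) (λ _ → tt)

bounded-notLongSum : ∀ {k} (ms : Vec ℕ (suc k)) {P : Subset (sumω ms)} b →
  (∀ {u} → P u → u ≺[ sumω ms ] b) → ¬ LongSum (sumω ms) ms P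
bounded-notLongSum (m ∷ []) {P} (inj₁ c) bounded long =
  bounded-notLong m c bounded
    (transport-Long (flip (graph inl)) m
      (matches-flip (matches-graph inl only-left (λ _ → ⇔-id _))) long)
  where
    only-left : ∀ {u} → P u → Σ (Vec ℕ m) λ v → inj₁ v ≡ u
    only-left {inj₁ v} _ = v , refl
    only-left {inj₂ ()}
bounded-notLongSum (m ∷ m' ∷ ms) {P} b bounded (inj₁ v , _ , front , _) =
  bounded-notLong m v proj₂
    (transport-Long (flip (graph inl)) m
      (matches-flip (matches-graph inl (λ (_ , u<v) → below-left (ω^ m) (sumω (m' ∷ ms)) u<v)
                                       (λ _ → ⇔-id _)))
      front)
bounded-notLongSum (m ∷ m' ∷ ms) (inj₁ _) bounded (inj₂ y , py , _) = bounded py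
bounded-notLongSum (m ∷ m' ∷ ms) (inj₂ b) bounded (inj₂ y , _ , _ , rest) =
  bounded-notLongSum (m' ∷ ms) b (λ (pu , _) → bounded pu)
    (transport-LongSum (flip (graph inr)) (m' ∷ ms)
      (matches-flip (matches-graph inr (λ (_ , y≤u) → atLeast-right (ω^ m) (sumω (m' ∷ ms)) y≤u)
                                       (λ _ → ⇔-id _)))
      rest)

segment-embedding : ∀ {β α} → β <ord α → Embedding β α
segment-embedding i = record
  { fun       = f
  ; monotone  = monotone _ _
  ; injective = injective _ _
  }
  where open IsoToInitialSegment i

segment-matches : ∀ {β α} (i : β <ord α) →
  Matches (graph (segment-embedding i)) U (Below α (IsoToInitialSegment.bound i))
segment-matches i = matches-graph (segment-embedding i) (λ {a} → onto a) (λ b → mk⇔ (λ _ → below b) (λ _ → tt))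
  where open IsoToInitialSegment i

rank≡ : ∀ j → rank j ≡ 2 * j + 1
rank≡ zero    = refl
rank≡ (suc j) = begin
  suc (suc (rank j))      ≡⟨ cong (λ n → suc (suc n)) (rank≡ j) ⟩
  suc (suc (2 * j + 1))   ≡⟨ cong (_+ 1) (sym (*-distribˡ-+ 2 1 j)) ⟩
  2 * suc j + 1           ∎
  where open ≡-Reasoning

rank-≤ : ∀ {j M} → j ≤ M → rank j ≤ 2 * M + 1
rank-≤ {j} {M} j≤M = subst (_≤ 2 * M + 1) (sym (rank≡ j)) (+-monoˡ-≤ 1 (*-monoʳ-≤ 2 j≤M))

rankSum-≤ : ∀ {k} M (ms : Vec ℕ (suc k)) → (∀ i → lookup ms i ≤ M) → rankSum ms ≤ 2 * M + suc k
rankSum-≤ M (m ∷ [])      bounded = rank-≤ (bounded Fin.zero)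
rankSum-≤ {suc k} M (m ∷ m' ∷ ms) bounded = begin
  suc (rank m ⊔ rankSum (m' ∷ ms)) ≤⟨ s≤s (⊔-lub rank-m≤ (rankSum-≤ M (m' ∷ ms) (λ i → bounded (Fin.suc i)))) ⟩
  suc (2 * M + suc k)              ≡⟨ sym (+-suc (2 * M) (suc k)) ⟩
  2 * M + suc (suc k)              ∎
  where
    open ≤-Reasoning
    rank-m≤ : rank m ≤ 2 * M + suc k
    rank-m≤ = ≤-trans (rank-≤ (bounded Fin.zero)) (+-monoʳ-≤ (2 * M) (s≤s z≤n))

-- If II won the (2m₀+k)-move game on α and β < α, she would in
-- particular win the rankSum-move game; it carries LongSum from α to β, and
-- the embedding of β into α carries it to the bounded part of α below the
-- bound of β — impossible.
lemma1p4 : (k : ℕ) (ms : Vec ℕ (suc k)) → NonIncreasing ms →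
    (β : LinOrd) → β <ord sumω ms →
    ¬ (sumω ms ≡[ 2 * head ms + suc k ] β)
lemma1p4 k ms@(_ ∷ _) nonIncreasing β β<α α≡β =
  bounded-notLongSum ms (IsoToInitialSegment.bound β<α) (λ u<bound → u<bound)
    (transport-LongSum (graph (segment-embedding β<α)) ms (segment-matches β<α) longβ)
  where
    α = sumω ms
    enoughMoves : rankSum ms ≤ 2 * head ms + suc k
    enoughMoves = rankSum-≤ (head ms) ms (λ i → nonIncreasing Fin.zero i z≤n)
    longβ : LongSum β ms U
    longβ = Game.transfer-LongSum α β ms (λ _ _ _ → ⇔-id _)
              (Game.weaken α β [] enoughMoves α≡β) (sumω-longSum ms)
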